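{- Let $n,s$ be positive integers and put $$N(n,s)=\sum_{m=1}^{n}\sum_{q=1}^{\min(m,s)}\binom{s}{q}2^{q-1}\left\{\binom{ -1+\frac{m}{2}}{q-1}'+\binom{m-1}{q-1}\right\},\qquad S(n,s)=-\frac12+\sum_{q=0}^{s}2^{q-1}\binom{s}{q}\binom{n}{q}.$$ Then $N(n,s)=S(n,s)+S\!\left(\lfloor n/2\rfloor,s\right)$. Moreover, for fixed $s$, as $n\to\infty$, $S(n,s)$ is asymptotically equivalent to $-\frac12+2^{s-1}\frac{n^s}{s!}$ and $N(n,s)$ is asymptotically equivalent to $-1+\frac12(2^s+1)\frac{n^s}{s!}$.
   Context: For real $p$ and integer $q$, $\binom{p}{q}'$ denotes $\binom{p}{q}$ if $p$ and $q$ are nonnegative integers, and $0$ otherwise; $\binom{n}{q}=0$ for $q>n$. $\lfloor x\rfloor$ is the integer part. Asymptotic equivalence means the ratio tends to $1$. (Motivation: for a local ring $R$ with $2\in R^*$, $|R^*:R^{*2}|=2$, maximal ideal nilpotent of step $s$ and $R^*\cap(1+R^2)\not\subseteq R^{*2}$, this sum is known to count the classes of projectively congruent quadrics of $RP_{n-1}$.) -}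

module Defs where

open import Data.Nat as ℕ using (ℕ; zero; suc; _∸_; _⊓_; _≥_)
open import Data.Nat.Properties using (_!≢0)
open import Data.Nat.Combinatorics using (_C_)
open import Data.Integer as ℤ using (ℤ; +_)
open import Data.Rational using (ℚ; mkℚ; 0ℚ; 1ℚ; ½; _+_; _*_; _-_; -_; _/_; ∣_∣; _≤_; _<_)
open import Data.Product using (∃-syntax)

ℕ→ℚ : ℕ → ℚ
ℕ→ℚ n = + n / 1

-- Σ_{i = a}^{b} f i  (empty, i.e. 0, when b < a)
sumCount : ℕ → (ℕ → ℚ) → ℚ
sumCount zero    f = 0ℚ
sumCount (suc k) f = f 0 + sumCount k (λ i → f (suc i))

Σ[_⋯_] : ℕ → ℕ → (ℕ → ℚ) → ℚ
Σ[ a ⋯ b ] f = sumCount (suc b ∸ a) (λ i → f (a ℕ.+ i))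

-- primed binomial: binom′ p q = (p choose q) if p, q are nonnegative
-- integers, and 0 otherwise (for nat arguments, p C q = 0 when q > p).
binom′ : ℚ → ℤ → ℚ
binom′ (mkℚ (+ a) zero _) (+ b) = ℕ→ℚ (a C b)
binom′ _ _ = 0ℚ

Nfun : ℕ → ℕ → ℚ
Nfun n s =
  Σ[ 1 ⋯ n ] λ m →
    Σ[ 1 ⋯ (m ⊓ s) ] λ q →
      ℕ→ℚ (s C q) * ℕ→ℚ (2 ℕ.^ (q ∸ 1))
        * (binom′ (- 1ℚ + (+ m / 2)) (+ q ℤ.- + 1) + ℕ→ℚ ((m ∸ 1) C (q ∸ 1)))

-- S(n,s); 2^{q-1} is written ½ * 2^q (so that q = 0 gives 1/2)
Sfun : ℕ → ℕ → ℚ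
Sfun n s =
  - ½ + (Σ[ 0 ⋯ s ] λ q → ½ * ℕ→ℚ (2 ℕ.^ q) * ℕ→ℚ (s C q) * ℕ→ℚ (n C q))

powOverFact : ℕ → ℕ → ℚ
powOverFact n s = + (n ℕ.^ s) / (s ℕ.!)
  where instance _ = s !≢0

-- asymptotic equivalence of sequences (ratio tends to 1), stated
-- division-free as:  f n = g n (1 + o(1))
_∼_ : (ℕ → ℚ) → (ℕ → ℚ) → Set
f ∼ g = ∀ (ε : ℚ) → 0ℚ < ε → ∃[ N ] (∀ n → n ≥ N → ∣ f n - g n ∣ ≤ ε * ∣ g n ∣)

module Submission where

-- Put w j = (s choose j+1) 2^j (the coefficient for q = j + 1).  Then S(n,s) = S′ n :=
-- Σ_{j<s} w j (n choose j+1), since the q = 0 term 1/2 cancels the −1/2, and by Pascal's rule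
-- ΔS′ n := Σ_{j<s} w j (n choose j) is the forward difference of S′, so it sums to S′ n.  The
-- summand m = i + 1 of N is H m + ΔS′ i, where H m carries the primed binomials ((−1+m/2) choose j)′:
-- these vanish for odd m and equal (k choose j) for m = 2k + 2, so H sums to S′ ⌊n/2⌋.
--
-- Multiplying by c = 2 s! turns S, N and the claimed asymptotes into integer
-- sequences.  As s! (n choose s) is the falling factorial n (n−1) ⋯ (n−s+1) = n^s + O(n^(s−1)), the
-- integer forms agree up to O(n^(s−1)) (Closeness, FallingFactorial, Growth), and a sequence within
-- O(n^(s−1)) of one growing like n^s is asymptotically equivalent to it (Dominance, Asymptotics).

open import Data.Nat using (ℕ)

module FiniteSums where

  open import Data.Nat
  open import Data.Nat.Properties
  open import Data.Sum using (_⊎_; inj₁; inj₂)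
  open import Relation.Binary.PropositionalEquality
  open import Algebra.Properties.CommutativeSemigroup +-commutativeSemigroup using (interchange)

  -- Σ k f = f 0 + f 1 + … + f (k − 1), built from the right so that telescoping is immediate.
  Σ : ℕ → (ℕ → ℕ) → ℕ
  Σ zero    f = 0
  Σ (suc k) f = Σ k f + f k

  Σ-cong : ∀ k {f g : ℕ → ℕ} → (∀ j → j < k → f j ≡ g j) → Σ k f ≡ Σ k g
  Σ-cong zero    eq = refl
  Σ-cong (suc k) eq = cong₂ _+_ (Σ-cong k (λ j j<k → eq j (m<n⇒m<1+n j<k))) (eq k (n<1+n k))

  Σ-+ : ∀ k (f g : ℕ → ℕ) → Σ k (λ j → f j + g j) ≡ Σ k f + Σ k g
  Σ-+ zero    f g = refl
  Σ-+ (suc k) f g = trans (cong (_+ (f k + g k)) (Σ-+ k f g)) (interchange (Σ k f) (Σ k g) (f k) (g k))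

  Σ-zero : ∀ k {f : ℕ → ℕ} → (∀ j → f j ≡ 0) → Σ k f ≡ 0
  Σ-zero zero    vanish = refl
  Σ-zero (suc k) vanish = cong₂ _+_ (Σ-zero k vanish) (vanish k)

  Σ-⊓ : ∀ a k (f : ℕ → ℕ) → (∀ j → a ≤ j → f j ≡ 0) → Σ (a ⊓ k) f ≡ Σ k f
  Σ-⊓ a k f vanish with ≤-total a k
  ... | inj₂ k≤a rewrite m≥n⇒m⊓n≡n k≤a = refl
  ... | inj₁ a≤k rewrite m≤n⇒m⊓n≡m a≤k = sym (drop a≤k)
    where
    drop : ∀ {k} → a ≤ k → Σ k f ≡ Σ a f
    drop {k} a≤k with m≤n⇒m<n∨m≡n a≤k
    ... | inj₂ refl = refl
    drop {suc k} _ | inj₁ (s≤s a≤k) = trans (cong₂ _+_ (drop a≤k) (vanish k a≤k)) (+-identityʳ _)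

  Σ-bound : ∀ k (f c : ℕ → ℕ) x → (∀ j → j < k → f j ≤ c j * x) → Σ k f ≤ Σ k c * x
  Σ-bound zero    f c x bound = z≤n
  Σ-bound (suc k) f c x bound = ≤-trans
    (+-mono-≤ (Σ-bound k f c x (λ j j<k → bound j (m<n⇒m<1+n j<k))) (bound k (n<1+n k)))
    (≤-reflexive (sym (*-distribʳ-+ x (Σ k c) (c k))))

  telescope : (F d : ℕ → ℕ) → F 0 ≡ 0 → (∀ i → F (suc i) ≡ F i + d i) → ∀ n → Σ n d ≡ F n
  telescope F d F0 step zero    = sym F0
  telescope F d F0 step (suc n) = trans (cong (_+ d n) (telescope F d F0 step n)) (sym (step n))

  halves : ∀ n → n ≡ ⌊ n /2⌋ + ⌊ n /2⌋ ⊎ n ≡ suc (⌊ n /2⌋ + ⌊ n /2⌋)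
  halves zero          = inj₁ refl
  halves (suc zero)    = inj₂ refl
  halves (suc (suc n)) with halves n
  ... | inj₁ e = inj₁ (cong suc (trans (cong suc e) (sym (+-suc ⌊ n /2⌋ ⌊ n /2⌋))))
  ... | inj₂ e = inj₂ (cong suc (trans (cong suc e) (cong suc (sym (+-suc ⌊ n /2⌋ ⌊ n /2⌋)))))

  module _ (h d : ℕ → ℕ) (even : ∀ k → h (k + k) ≡ 0) (odd : ∀ k → h (suc (k + k)) ≡ d k) where

    Σ-pairs : ∀ k → Σ (k + k) h ≡ Σ k d
    Σ-pairs zero    = refl
    Σ-pairs (suc k) = begin
      Σ (suc k + suc k) h                       ≡⟨ cong (λ m → Σ (suc m) h) (+-suc k k) ⟩
      Σ (k + k) h + h (k + k) + h (suc (k + k)) ≡⟨ cong₂ (λ x y → x + y + h (suc (k + k))) (Σ-pairs k) (even k) ⟩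
      Σ k d + 0 + h (suc (k + k))               ≡⟨ cong₂ _+_ (+-identityʳ (Σ k d)) (odd k) ⟩
      Σ k d + d k                               ∎
      where open ≡-Reasoning

    Σ-odd : ∀ n → Σ n h ≡ Σ ⌊ n /2⌋ d
    Σ-odd n with halves n
    ... | inj₁ e = trans (cong (λ m → Σ m h) e) (Σ-pairs ⌊ n /2⌋)
    ... | inj₂ e = trans (cong (λ m → Σ m h) e)
                     (trans (cong₂ _+_ (Σ-pairs ⌊ n /2⌋) (even ⌊ n /2⌋)) (+-identityʳ _))

module HalfBinomial where

  open import Data.Nat
  open import Data.Nat.Properties
  open import Data.Nat.Combinatorics using (_C_; k>n⇒nCk≡0)
  open import Data.Bool using (Bool; true; false; if_then_else_)
  open import Relation.Binary.PropositionalEquality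

  isEven : ℕ → Bool
  isEven zero          = true
  isEven (suc zero)    = false
  isEven (suc (suc n)) = isEven n

  isEven-double : ∀ k → isEven (k + k) ≡ true
  isEven-double zero    = refl
  isEven-double (suc k) rewrite +-suc k k = isEven-double k

  isEven-odd : ∀ k → isEven (suc (k + k)) ≡ false
  isEven-odd zero    = refl
  isEven-odd (suc k) rewrite +-suc k k = isEven-odd k

  -- The natural-number value of the primed binomial ((−1 + m/2) choose j)′ for m ≥ 1:
  -- (m/2 − 1 choose j) when m is even, and 0 when m is odd (then −1 + m/2 ∉ ℕ).
  halfBinom : ℕ → ℕ → ℕ
  halfBinom m j = if isEven m then (⌊ m /2⌋ ∸ 1) C j else 0

  halfBinom-odd : ∀ k j → halfBinom (suc (k + k)) j ≡ 0
  halfBinom-odd k j rewrite isEven-odd k = refl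

  halfBinom-even : ∀ k j → halfBinom (suc k + suc k) j ≡ k C j
  halfBinom-even k j rewrite isEven-double (suc k) | sym (n≡⌊n+n/2⌋ (suc k)) = refl

  halfBinom-vanish : ∀ i j → i < j → halfBinom (suc i) j ≡ 0
  halfBinom-vanish i j i<j with isEven (suc i)
  ... | false = refl
  ... | true  = k>n⇒nCk≡0 (≤-<-trans (∸-monoˡ-≤ 1 (⌊n/2⌋≤n (suc i))) i<j)

module CombinatorialIdentity (s : ℕ) where

  open import Data.Nat
  open import Data.Nat.Properties
  open import Data.Nat.Combinatorics using (_C_; k>n⇒nCk≡0; nCk+nC[k+1]≡[n+1]C[k+1])
  open import Relation.Binary.PropositionalEquality
  open FiniteSums
  open HalfBinomial

  -- The coefficient (s choose q)·2^(q−1) of the paper, indexed by j = q − 1.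
  weight : ℕ → ℕ
  weight j = (s C suc j) * 2 ^ j

  -- S(n,s) without its q = 0 term (which cancels the −1/2): Σ_{q=1}^{s} (s choose q) 2^(q−1) (n choose q).
  S′ : ℕ → ℕ
  S′ n = Σ s (λ j → weight j * (n C suc j))

  ΔS′ : ℕ → ℕ
  ΔS′ n = Σ s (λ j → weight j * (n C j))

  -- S′ starts at 0 and grows by ΔS′ (Pascal's rule), so ΔS′ telescopes to S′.
  S′-zero : S′ 0 ≡ 0
  S′-zero = Σ-zero s (λ j → *-zeroʳ (weight j))

  S′-step : ∀ n → S′ (suc n) ≡ S′ n + ΔS′ n
  S′-step n = trans (Σ-cong s pascal) (Σ-+ s _ _)
    where
    pascal : ∀ j → j < s → weight j * (suc n C suc j) ≡ weight j * (n C suc j) + weight j * (n C j)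
    pascal j _ = begin
      weight j * (suc n C suc j)                  ≡⟨ cong (weight j *_) (sym (nCk+nC[k+1]≡[n+1]C[k+1] n j)) ⟩
      weight j * (n C j + n C suc j)              ≡⟨ cong (weight j *_) (+-comm (n C j) (n C suc j)) ⟩
      weight j * (n C suc j + n C j)              ≡⟨ *-distribˡ-+ (weight j) (n C suc j) (n C j) ⟩
      weight j * (n C suc j) + weight j * (n C j) ∎
      where open ≡-Reasoning

  ΣΔS′ : ∀ n → Σ n ΔS′ ≡ S′ n
  ΣΔS′ = telescope S′ ΔS′ S′-zero S′-step

  -- The primed-binomial part of the m-th summand of N: Σ_q (s choose q) 2^(q−1) ((−1 + m/2) choose (q−1))′.
  H : ℕ → ℕ
  H m = Σ s (λ j → weight j * halfBinom m j)

  H-odd : ∀ k → H (suc (k + k)) ≡ 0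
  H-odd k = Σ-zero s (λ j → trans (cong (weight j *_) (halfBinom-odd k j)) (*-zeroʳ (weight j)))

  H-even : ∀ k → H (suc (suc (k + k))) ≡ ΔS′ k
  H-even k = Σ-cong s (λ j _ → cong (weight j *_) (trans (cong (λ m → halfBinom (suc m) j) (sym (+-suc k k))) (halfBinom-even k j)))

  -- Summing H over m = 1 … n gives S′ ⌊n/2⌋: only the even m = 2k + 2 contribute, namely ΔS′ k.
  ΣH : ∀ n → Σ n (λ i → H (suc i)) ≡ S′ ⌊ n /2⌋
  ΣH n = trans (Σ-odd (λ i → H (suc i)) ΔS′ H-odd H-even n) (ΣΔS′ ⌊ n /2⌋)

  -- The m-th summand of N(n,s), for m = i + 1; the inner sum runs over q = j + 1 ≤ min(m, s).
  summandN : ℕ → ℕ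
  summandN i = Σ (suc i ⊓ s) (λ j → weight j * (halfBinom (suc i) j + i C j))

  -- Above q = m all terms vanish, so the inner sum may run to s; then it splits as H m + ΔS′ (m − 1).
  summandN-split : ∀ i → summandN i ≡ H (suc i) + ΔS′ i
  summandN-split i = begin
    summandN i                                                      ≡⟨ Σ-⊓ (suc i) s _ vanish ⟩
    Σ s (λ j → weight j * (halfBinom (suc i) j + i C j))            ≡⟨ Σ-cong s (λ j _ → *-distribˡ-+ (weight j) _ _) ⟩
    Σ s (λ j → weight j * halfBinom (suc i) j + weight j * (i C j)) ≡⟨ Σ-+ s _ _ ⟩
    H (suc i) + ΔS′ i                                               ∎
    where
    open ≡-Reasoning
    vanish : ∀ j → suc i ≤ j → weight j * (halfBinom (suc i) j + i C j) ≡ 0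
    vanish j i<j rewrite halfBinom-vanish i j i<j | k>n⇒nCk≡0 i<j = *-zeroʳ (weight j)

  N′ : ℕ → ℕ
  N′ n = Σ n summandN

  N′-identity : ∀ n → N′ n ≡ S′ n + S′ ⌊ n /2⌋
  N′-identity n = begin
    Σ n summandN                              ≡⟨ Σ-cong n (λ i _ → summandN-split i) ⟩
    Σ n (λ i → H (suc i) + ΔS′ i)             ≡⟨ Σ-+ n _ _ ⟩
    Σ n (λ i → H (suc i)) + Σ n ΔS′           ≡⟨ cong₂ _+_ (ΣH n) (ΣΔS′ n) ⟩
    S′ ⌊ n /2⌋ + S′ n                         ≡⟨ +-comm (S′ ⌊ n /2⌋) (S′ n) ⟩
    S′ n + S′ ⌊ n /2⌋                         ∎
    where open ≡-Reasoning

module Embedding where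

  open import Defs using (ℕ→ℚ; sumCount; binom′)
  open import Data.Nat as ℕ using (ℕ; zero; suc)
  import Data.Nat.Properties as ℕ
  open import Data.Nat.Coprimality using (1-coprimeTo; sym)
  open import Data.Integer as ℤ using (+_; -[1+_])
  open import Data.Empty using (⊥-elim)
  open import Data.Nat.Combinatorics using (_C_)
  import Data.Integer.Properties as ℤ
  open import Data.Rational
  open import Data.Rational.Properties
  open import Data.Rational.Solver using (module +-*-Solver)
  import Data.Rational.Unnormalised as ᵘ
  import Data.Rational.Unnormalised.Properties as ᵘ
  open import Data.Sum using (inj₁; inj₂)
  open import Relation.Binary.PropositionalEquality hiding (sym)
  open +-*-Solver using (solve; _:+_; _:-_; :-_; _:=_; con)
  import Relation.Binary.PropositionalEquality as ≡
  open FiniteSums using (Σ)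

  ⟦_⟧ : ℕ → ℚ
  ⟦ n ⟧ = ℕ→ℚ n

  ⟦⟧-mkℚ : ∀ n → ⟦ n ⟧ ≡ mkℚ (+ n) 0 (sym (1-coprimeTo n))
  ⟦⟧-mkℚ n = normalize-coprime (sym (1-coprimeTo n))

  ⟦+⟧ : ∀ a b → ⟦ a ℕ.+ b ⟧ ≡ ⟦ a ⟧ + ⟦ b ⟧
  ⟦+⟧ a b = trans (cong (_/ 1) (≡.sym (cong₂ ℤ._+_ (ℤ.*-identityʳ (+ a)) (ℤ.*-identityʳ (+ b)))))
                  (≡.sym (cong₂ _+_ (⟦⟧-mkℚ a) (⟦⟧-mkℚ b)))

  ⟦*⟧ : ∀ a b → ⟦ a ℕ.* b ⟧ ≡ ⟦ a ⟧ * ⟦ b ⟧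
  ⟦*⟧ a b = trans (cong (_/ 1) (ℤ.pos-* a b)) (≡.sym (cong₂ _*_ (⟦⟧-mkℚ a) (⟦⟧-mkℚ b)))

  ⟦≤⟧ : ∀ {a b} → a ℕ.≤ b → ⟦ a ⟧ ≤ ⟦ b ⟧
  ⟦≤⟧ {a} {b} a≤b rewrite ⟦⟧-mkℚ a | ⟦⟧-mkℚ b = *≤* (ℤ.*-monoʳ-≤-nonNeg (+ 1) (ℤ.+≤+ a≤b))

  ⟦⟧-injective : ∀ {a b} → ⟦ a ⟧ ≡ ⟦ b ⟧ → a ≡ b
  ⟦⟧-injective {a} {b} eq = ℤ.+-injective (cong ↥_ (trans (≡.sym (⟦⟧-mkℚ a)) (trans eq (⟦⟧-mkℚ b))))

  ∣⟦⟧∣ : ∀ a → ∣ ⟦ a ⟧ ∣ ≡ ⟦ a ⟧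
  ∣⟦⟧∣ a rewrite ⟦⟧-mkℚ a = refl

  ⟦∣-∣⟧ : ∀ a b → ∣ ⟦ a ⟧ - ⟦ b ⟧ ∣ ≡ ⟦ ℕ.∣ a - b ∣ ⟧
  ⟦∣-∣⟧ a b with ℕ.≤-total b a
  ... | inj₁ b≤a = begin
    ∣ ⟦ a ⟧ - ⟦ b ⟧ ∣                 ≡⟨ cong (λ x → ∣ ⟦ x ⟧ - ⟦ b ⟧ ∣) (≡.sym (ℕ.m∸n+n≡m b≤a)) ⟩
    ∣ ⟦ a ℕ.∸ b ℕ.+ b ⟧ - ⟦ b ⟧ ∣     ≡⟨ cong (λ x → ∣ x - ⟦ b ⟧ ∣) (⟦+⟧ (a ℕ.∸ b) b) ⟩
    ∣ ⟦ a ℕ.∸ b ⟧ + ⟦ b ⟧ - ⟦ b ⟧ ∣   ≡⟨ cong ∣_∣ (solve 2 (λ x y → x :+ y :- y := x) refl ⟦ a ℕ.∸ b ⟧ ⟦ b ⟧) ⟩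
    ∣ ⟦ a ℕ.∸ b ⟧ ∣                   ≡⟨ ∣⟦⟧∣ (a ℕ.∸ b) ⟩
    ⟦ a ℕ.∸ b ⟧                       ≡⟨ cong ⟦_⟧ (≡.sym (ℕ.m≤n⇒∣n-m∣≡n∸m b≤a)) ⟩
    ⟦ ℕ.∣ a - b ∣ ⟧                   ∎
    where open ≡-Reasoning
  ... | inj₂ a≤b = begin
    ∣ ⟦ a ⟧ - ⟦ b ⟧ ∣                 ≡⟨ cong (λ x → ∣ ⟦ a ⟧ - ⟦ x ⟧ ∣) (≡.sym (ℕ.m∸n+n≡m a≤b)) ⟩
    ∣ ⟦ a ⟧ - ⟦ b ℕ.∸ a ℕ.+ a ⟧ ∣     ≡⟨ cong (λ x → ∣ ⟦ a ⟧ - x ∣) (⟦+⟧ (b ℕ.∸ a) a) ⟩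
    ∣ ⟦ a ⟧ - (⟦ b ℕ.∸ a ⟧ + ⟦ a ⟧) ∣ ≡⟨ cong ∣_∣ (solve 2 (λ x y → x :- (y :+ x) := :- y) refl ⟦ a ⟧ ⟦ b ℕ.∸ a ⟧) ⟩
    ∣ - ⟦ b ℕ.∸ a ⟧ ∣                 ≡⟨ trans (∣-p∣≡∣p∣ _) (∣⟦⟧∣ (b ℕ.∸ a)) ⟩
    ⟦ b ℕ.∸ a ⟧                       ≡⟨ cong ⟦_⟧ (≡.sym (ℕ.m≤n⇒∣m-n∣≡n∸m a≤b)) ⟩
    ⟦ ℕ.∣ a - b ∣ ⟧                   ∎
    where open ≡-Reasoning

  -- A fraction a/d times d is a; this is all we use about the division in N, S and n^s/s!.
  /-*-cancel : ∀ a d .{{_ : ℕ.NonZero d}} → (+ a / d) * ⟦ d ⟧ ≡ ⟦ a ⟧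
  /-*-cancel a (suc d) = toℚᵘ-injective (begin
    toℚᵘ ((+ a / suc d) * ⟦ suc d ⟧)             ≈⟨ toℚᵘ-homo-* (+ a / suc d) ⟦ suc d ⟧ ⟩
    toℚᵘ (+ a / suc d) ᵘ.* toℚᵘ ⟦ suc d ⟧        ≈⟨ ᵘ.*-congʳ (toℚᵘ-fromℚᵘ (ᵘ.mkℚᵘ (+ a) d)) ⟩
    ᵘ.mkℚᵘ (+ a) d ᵘ.* toℚᵘ ⟦ suc d ⟧            ≡⟨ cong (ᵘ.mkℚᵘ (+ a) d ᵘ.*_) (cong toℚᵘ (⟦⟧-mkℚ (suc d))) ⟩
    ᵘ.mkℚᵘ (+ a) d ᵘ.* ᵘ.mkℚᵘ (+ suc d) 0        ≈⟨ ᵘ.*≡* (ℤ.*-assoc (+ a) (+ suc d) (+ 1)) ⟩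
    ᵘ.mkℚᵘ (+ a) 0                               ≡⟨ cong toℚᵘ (≡.sym (⟦⟧-mkℚ a)) ⟩
    toℚᵘ ⟦ a ⟧                                   ∎)
    where open ᵘ.≃-Reasoning

  -- Cancelling a factor 2 (2 · ½ = 1 holds by computation).
  cancel-2 : ∀ {x y} → x * ⟦ 2 ⟧ ≡ y * ⟦ 2 ⟧ → x ≡ y
  cancel-2 {x} {y} eq = begin
    x                 ≡⟨ ≡.sym (*-identityʳ x) ⟩
    x * (⟦ 2 ⟧ * ½)   ≡⟨ ≡.sym (*-assoc x ⟦ 2 ⟧ ½) ⟩
    x * ⟦ 2 ⟧ * ½     ≡⟨ cong (_* ½) eq ⟩
    y * ⟦ 2 ⟧ * ½     ≡⟨ *-assoc y ⟦ 2 ⟧ ½ ⟩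
    y * (⟦ 2 ⟧ * ½)   ≡⟨ *-identityʳ y ⟩
    y                 ∎
    where open ≡-Reasoning

  shifted-half : ∀ m a → - 1ℚ + (+ m / 2) ≡ ⟦ a ⟧ → m ≡ 2 ℕ.* suc a
  shifted-half m a eq = ⟦⟧-injective (begin
    ⟦ m ⟧                          ≡⟨ ≡.sym (/-*-cancel m 2) ⟩
    (+ m / 2) * ⟦ 2 ⟧              ≡⟨ cong (_* ⟦ 2 ⟧) (solve 1 (λ y → y := con 1ℚ :+ (con (- 1ℚ) :+ y)) refl (+ m / 2)) ⟩
    (1ℚ + (- 1ℚ + (+ m / 2))) * ⟦ 2 ⟧ ≡⟨ cong (λ x → (1ℚ + x) * ⟦ 2 ⟧) eq ⟩
    (⟦ 1 ⟧ + ⟦ a ⟧) * ⟦ 2 ⟧        ≡⟨ ≡.sym (trans (⟦*⟧ (suc a) 2) (cong (_* ⟦ 2 ⟧) (⟦+⟧ 1 a))) ⟩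
    ⟦ suc a ℕ.* 2 ⟧                ≡⟨ cong ⟦_⟧ (ℕ.*-comm (suc a) 2) ⟩
    ⟦ 2 ℕ.* suc a ⟧                ∎)
    where open ≡-Reasoning

  shifted-half-even : ∀ a → - 1ℚ + (+ (2 ℕ.* suc a) / 2) ≡ ⟦ a ⟧
  shifted-half-even a = begin
    - 1ℚ + (+ (2 ℕ.* suc a) / 2)   ≡⟨ cong (λ x → - 1ℚ + x) (cancel-2 {+ (2 ℕ.* suc a) / 2} {⟦ 1 ⟧ + ⟦ a ⟧} (trans (/-*-cancel (2 ℕ.* suc a) 2) twice)) ⟩
    - 1ℚ + (⟦ 1 ⟧ + ⟦ a ⟧)         ≡⟨ solve 1 (λ x → con (- 1ℚ) :+ (con 1ℚ :+ x) := x) refl ⟦ a ⟧ ⟩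
    ⟦ a ⟧                          ∎
    where
    open ≡-Reasoning
    twice : ⟦ 2 ℕ.* suc a ⟧ ≡ (⟦ 1 ⟧ + ⟦ a ⟧) * ⟦ 2 ⟧
    twice = trans (cong ⟦_⟧ (ℕ.*-comm 2 (suc a))) (trans (⟦*⟧ (suc a) 2) (cong (_* ⟦ 2 ⟧) (⟦+⟧ 1 a)))

  binom′-ℕ : ∀ {x} a j → x ≡ ⟦ a ⟧ → binom′ x (+ j) ≡ ⟦ a C j ⟧
  binom′-ℕ a j refl = cong (λ x → binom′ x (+ j)) (⟦⟧-mkℚ a)

  binom′-non-ℕ : ∀ x j → (∀ a → x ≢ ⟦ a ⟧) → binom′ x (+ j) ≡ 0ℚ
  binom′-non-ℕ (mkℚ (+ a) zero    c) j notℕ = ⊥-elim (notℕ a (≡.sym (⟦⟧-mkℚ a)))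
  binom′-non-ℕ (mkℚ (+ a) (suc d) c) j notℕ = refl
  binom′-non-ℕ (mkℚ -[1+ a ] d    c) j notℕ = refl

  -- The sums of the statement peel off their first term; ours their last.
  sumCount-snoc : ∀ k (g : ℕ → ℚ) → sumCount (suc k) g ≡ sumCount k g + g k
  sumCount-snoc zero    g = trans (+-identityʳ (g 0)) (≡.sym (+-identityˡ (g 0)))
  sumCount-snoc (suc k) g = trans (cong (λ x → g 0 + x) (sumCount-snoc k (λ i → g (suc i)))) (≡.sym (+-assoc (g 0) _ _))

  sumCount-⟦⟧ : ∀ k {g : ℕ → ℚ} (f : ℕ → ℕ) → (∀ i → g i ≡ ⟦ f i ⟧) → sumCount k g ≡ ⟦ Σ k f ⟧
  sumCount-⟦⟧ zero    f eq = refl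
  sumCount-⟦⟧ (suc k) {g} f eq = begin
    sumCount (suc k) g     ≡⟨ sumCount-snoc k g ⟩
    sumCount k g + g k     ≡⟨ cong₂ _+_ (sumCount-⟦⟧ k f eq) (eq k) ⟩
    ⟦ Σ k f ⟧ + ⟦ f k ⟧    ≡⟨ ≡.sym (⟦+⟧ (Σ k f) (f k)) ⟩
    ⟦ Σ (suc k) f ⟧        ∎
    where open ≡-Reasoning

module Bridge (s : ℕ) where

  open import Defs
  open import Data.Nat as ℕ using (ℕ; zero; suc; ⌊_/2⌋)
  import Data.Nat.Properties as ℕ
  open import Data.Nat.Combinatorics using (_C_)
  open import Data.Integer using (+_)
  open import Data.Rational using (ℚ; 1ℚ; ½; _+_; _*_; -_; _/_)
  open import Data.Rational.Properties using (*-identityˡ)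
  open import Data.Rational.Solver using (module +-*-Solver)
  open import Data.Sum using (_⊎_; inj₁; inj₂)
  open import Relation.Binary.PropositionalEquality
  open +-*-Solver using (solve; _:+_; _:*_; _:=_; con)
  open FiniteSums using (halves)
  open HalfBinomial
  open CombinatorialIdentity s
  open Embedding

  binom′-half : ∀ i j → binom′ (- 1ℚ + (+ suc i / 2)) (+ j) ≡ ⟦ halfBinom (suc i) j ⟧
  binom′-half i j = by-parity ⌊ suc i /2⌋ (halves (suc i))
    where
    P : ℕ → Set
    P m = binom′ (- 1ℚ + (+ m / 2)) (+ j) ≡ ⟦ halfBinom m j ⟧

    even : ∀ a → P (suc a ℕ.+ suc a)
    even a rewrite halfBinom-even a j =
      binom′-ℕ a j (subst (λ m → - 1ℚ + (+ m / 2) ≡ ⟦ a ⟧) (cong (suc a ℕ.+_) (ℕ.+-identityʳ (suc a))) (shifted-half-even a))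

    odd : ∀ h → P (suc (h ℕ.+ h))
    odd h rewrite halfBinom-odd h j = binom′-non-ℕ _ j (λ a eq → ℕ.even≢odd (suc a) h
      (trans (sym (shifted-half _ a eq)) (cong (λ x → suc (h ℕ.+ x)) (sym (ℕ.+-identityʳ h)))))

    by-parity : ∀ h → suc i ≡ h ℕ.+ h ⊎ suc i ≡ suc (h ℕ.+ h) → P (suc i)
    by-parity zero    (inj₁ ())
    by-parity (suc a) (inj₁ e) = subst P (sym e) (even a)
    by-parity h       (inj₂ e) = subst P (sym e) (odd h)

  -- S(n,s) is the embedding of S′ n: the q = 0 term ½ cancels the −½.
  Sfun≡S′ : ∀ n → Sfun n s ≡ ⟦ S′ n ⟧
  Sfun≡S′ n = begin
    Sfun n s                                    ≡⟨⟩
    - ½ + (½ * ⟦ 1 ⟧ * ⟦ 1 ⟧ * ⟦ 1 ⟧ + sumCount s term)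
        ≡⟨ cong (λ x → - ½ + (½ * ⟦ 1 ⟧ * ⟦ 1 ⟧ * ⟦ 1 ⟧ + x)) (sumCount-⟦⟧ s _ term≡) ⟩
    - ½ + (½ * ⟦ 1 ⟧ * ⟦ 1 ⟧ * ⟦ 1 ⟧ + ⟦ S′ n ⟧)
        ≡⟨ solve 1 (λ x → con (- ½) :+ (con ½ :* con 1ℚ :* con 1ℚ :* con 1ℚ :+ x) := x) refl ⟦ S′ n ⟧ ⟩
    ⟦ S′ n ⟧                                    ∎
    where
    open ≡-Reasoning
    term : ℕ → ℚ
    term j = ½ * ⟦ 2 ℕ.^ suc j ⟧ * ⟦ s C suc j ⟧ * ⟦ n C suc j ⟧

    term≡ : ∀ j → term j ≡ ⟦ weight j ℕ.* (n C suc j) ⟧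
    term≡ j = begin
      ½ * ⟦ 2 ℕ.* 2 ℕ.^ j ⟧ * ⟦ s C suc j ⟧ * ⟦ n C suc j ⟧
          ≡⟨ cong (λ x → ½ * x * ⟦ s C suc j ⟧ * ⟦ n C suc j ⟧) (⟦*⟧ 2 (2 ℕ.^ j)) ⟩
      ½ * (⟦ 2 ⟧ * ⟦ 2 ℕ.^ j ⟧) * ⟦ s C suc j ⟧ * ⟦ n C suc j ⟧
          ≡⟨ solve 5 (λ h t p c b → h :* (t :* p) :* c :* b := (h :* t) :* (c :* p :* b)) refl ½ ⟦ 2 ⟧ ⟦ 2 ℕ.^ j ⟧ ⟦ s C suc j ⟧ ⟦ n C suc j ⟧ ⟩
      1ℚ * (⟦ s C suc j ⟧ * ⟦ 2 ℕ.^ j ⟧ * ⟦ n C suc j ⟧)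
          ≡⟨ *-identityˡ _ ⟩
      ⟦ s C suc j ⟧ * ⟦ 2 ℕ.^ j ⟧ * ⟦ n C suc j ⟧
          ≡⟨ sym (trans (⟦*⟧ (weight j) (n C suc j)) (cong (_* ⟦ n C suc j ⟧) (⟦*⟧ (s C suc j) (2 ℕ.^ j)))) ⟩
      ⟦ weight j ℕ.* (n C suc j) ⟧ ∎

  Nfun≡N′ : ∀ n → Nfun n s ≡ ⟦ N′ n ⟧
  Nfun≡N′ n = sumCount-⟦⟧ n summandN (λ i → sumCount-⟦⟧ (suc i ℕ.⊓ s) _ (term≡ i))
    where
    term≡ : ∀ i j → ⟦ s C suc j ⟧ * ⟦ 2 ℕ.^ j ⟧ * (binom′ (- 1ℚ + (+ suc i / 2)) (+ j) + ⟦ i C j ⟧)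
                    ≡ ⟦ weight j ℕ.* (halfBinom (suc i) j ℕ.+ i C j) ⟧
    term≡ i j = trans (cong (λ b → ⟦ s C suc j ⟧ * ⟦ 2 ℕ.^ j ⟧ * (b + ⟦ i C j ⟧)) (binom′-half i j))
      (sym (trans (⟦*⟧ (weight j) _) (cong₂ _*_ (⟦*⟧ (s C suc j) (2 ℕ.^ j)) (⟦+⟧ (halfBinom (suc i) j) (i C j)))))

module FallingFactorial where

  open import Data.Nat
  open import Data.Nat.Properties
  open import Data.Nat.DivMod using (m*[n/m]≡n)
  open import Data.Nat.Combinatorics using (_C_; k>n⇒nCk≡0; nCk≡nPk/k!)
  open import Data.Nat.Combinatorics.Base using (_P_; _P′_)
  open import Data.Nat.Combinatorics.Specification using (k!∣nP′k; nPk≡n!/[n∸k]!; nP′k≡n!/[n∸k]!)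
  open import Data.Product using (∃-syntax; _,_)
  open import Data.Sum using (inj₁; inj₂)
  open import Relation.Nullary using (yes; no)
  open import Relation.Binary.PropositionalEquality
  open import Algebra.Properties.CommutativeSemigroup *-commutativeSemigroup using (x∙yz≈y∙xz)

  -- The falling factorial n P′ k = n (n−1) ⋯ (n−k+1) of the library has the factor n − n = 0 once k > n.
  P′-vanish : ∀ {n k} → n < k → n P′ k ≡ 0
  P′-vanish {n} {suc k} (s≤s n≤k) with m≤n⇒m<n∨m≡n n≤k
  ... | inj₁ n<k  = trans (cong ((n ∸ k) *_) (P′-vanish n<k)) (*-zeroʳ (n ∸ k))
  ... | inj₂ refl = cong (_* (n P′ n)) (n∸n≡0 n)

  k!C≡P′ : ∀ n k → k ! * (n C k) ≡ n P′ k
  k!C≡P′ n k with k ≤? n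
  ... | no  k≰n = trans (cong (k ! *_) (k>n⇒nCk≡0 (≰⇒> k≰n))) (trans (*-zeroʳ (k !)) (sym (P′-vanish (≰⇒> k≰n))))
  ... | yes k≤n = begin
    k ! * (n C k)             ≡⟨ cong (k ! *_) (nCk≡nPk/k! k≤n) ⟩
    k ! * ((n P k) / k !)     ≡⟨ cong (λ x → k ! * (x / k !)) (trans (nPk≡n!/[n∸k]! k≤n) (sym (nP′k≡n!/[n∸k]! k≤n))) ⟩
    k ! * ((n P′ k) / k !)    ≡⟨ m*[n/m]≡n (k!∣nP′k k≤n) ⟩
    n P′ k                    ∎
    where
    open ≡-Reasoning
    instance _ = k !≢0

  -- Each of its k factors is at most n.
  P′≤^ : ∀ n k → n P′ k ≤ n ^ k
  P′≤^ n zero    = ≤-refl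
  P′≤^ n (suc k) = *-mono-≤ (m∸n≤m n k) (P′≤^ n k)

  -- Conversely n^(k+1) exceeds the falling factorial by O(n^k): each factor n − i loses at most i.
  ^≤P′ : ∀ k → ∃[ c ] ∀ n → n ^ suc k ≤ n P′ suc k + c * n ^ k
  ^≤P′ zero    = 0 , λ n → m≤m+n (n * 1) 0
  ^≤P′ (suc k) with ^≤P′ k
  ... | c , bound = c + suc k , step
    where
    step : ∀ n → n ^ suc (suc k) ≤ n P′ suc (suc k) + (c + suc k) * n ^ suc k
    step n = begin
      n * n ^ suc k                                          ≤⟨ *-monoʳ-≤ n (bound n) ⟩
      n * (F + c * n ^ k)                                    ≡⟨ *-distribˡ-+ n F (c * n ^ k) ⟩
      n * F + n * (c * n ^ k)                                ≡⟨ cong (n * F +_) (x∙yz≈y∙xz n c (n ^ k)) ⟩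
      n * F + c * n ^ suc k                                  ≤⟨ +-monoˡ-≤ _ (*-monoˡ-≤ F (m≤n+m∸n n (suc k))) ⟩
      (suc k + (n ∸ suc k)) * F + c * n ^ suc k              ≡⟨ cong (_+ c * n ^ suc k) (*-distribʳ-+ F (suc k) (n ∸ suc k)) ⟩
      (suc k * F + (n ∸ suc k) * F) + c * n ^ suc k          ≤⟨ +-monoˡ-≤ _ (+-monoˡ-≤ _ (*-monoʳ-≤ (suc k) (P′≤^ n (suc k)))) ⟩
      (suc k * n ^ suc k + n P′ suc (suc k)) + c * n ^ suc k ≡⟨ regroup (suc k * n ^ suc k) (n P′ suc (suc k)) (c * n ^ suc k) ⟩
      n P′ suc (suc k) + (c * n ^ suc k + suc k * n ^ suc k) ≡⟨ cong (n P′ suc (suc k) +_) (sym (*-distribʳ-+ (n ^ suc k) c (suc k))) ⟩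
      n P′ suc (suc k) + (c + suc k) * n ^ suc k             ∎
      where
      open ≤-Reasoning
      F = n P′ suc k
      regroup : ∀ a b c → (a + b) + c ≡ b + (c + a)
      regroup a b c = trans (cong (_+ c) (+-comm a b)) (trans (+-assoc b a c) (cong (b +_) (+-comm a c)))

  C≤^ : ∀ n k → n C k ≤ n ^ k
  C≤^ n k = ≤-trans (m≤n*m (n C k) (k !) {{k !≢0}}) (≤-trans (≤-reflexive (k!C≡P′ n k)) (P′≤^ n k))

module Closeness where

  open import Data.Nat
  open import Data.Nat.Properties
  open import Relation.Binary.PropositionalEquality

  record Close (t : ℕ) (a b : ℕ → ℕ) : Set where
    constructor close
    field
      K     : ℕ
      bound : ∀ n → 1 ≤ n → ∣ a n - b n ∣ ≤ K * n ^ t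

  module _ {t : ℕ} where

    1≤^ : ∀ {n} → 1 ≤ n → 1 ≤ n ^ t
    1≤^ {suc n} _ = m^n>0 (suc n) t

    close-≡ : ∀ {a b} → (∀ n → a n ≡ b n) → Close t a b
    close-≡ {a} eq = close 0 λ n _ → ≤-reflexive (trans (cong (∣ a n -_∣) (sym (eq n))) (∣n-n∣≡0 (a n)))

    close-sym : ∀ {a b} → Close t a b → Close t b a
    close-sym {a} {b} (close K ab) = close K λ n n≥1 → subst (_≤ K * n ^ t) (∣-∣-comm (a n) (b n)) (ab n n≥1)

    close-trans : ∀ {a b c} → Close t a b → Close t b c → Close t a c
    close-trans {a} {b} {c} (close K ab) (close L bc) = close (K + L) λ n n≥1 → begin
      ∣ a n - c n ∣                 ≤⟨ ∣-∣-triangle (a n) (b n) (c n) ⟩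
      ∣ a n - b n ∣ + ∣ b n - c n ∣ ≤⟨ +-mono-≤ (ab n n≥1) (bc n n≥1) ⟩
      K * n ^ t + L * n ^ t         ≡⟨ sym (*-distribʳ-+ (n ^ t) K L) ⟩
      (K + L) * n ^ t               ∎
      where open ≤-Reasoning

    close-+ : ∀ {a b c d} → Close t a b → Close t c d → Close t (λ n → a n + c n) (λ n → b n + d n)
    close-+ {a} {b} {c} {d} (close K ab) (close L cd) = close (K + L) λ n n≥1 → begin
      ∣ a n + c n - b n + d n ∣                         ≤⟨ ∣-∣-triangle (a n + c n) (b n + c n) (b n + d n) ⟩
      ∣ a n + c n - b n + c n ∣ + ∣ b n + c n - b n + d n ∣ ≡⟨ cong₂ _+_ (shift (a n) (b n) (c n)) (∣m+n-m+o∣≡∣n-o∣ (b n) (c n) (d n)) ⟩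
      ∣ a n - b n ∣ + ∣ c n - d n ∣                     ≤⟨ +-mono-≤ (ab n n≥1) (cd n n≥1) ⟩
      K * n ^ t + L * n ^ t                             ≡⟨ sym (*-distribʳ-+ (n ^ t) K L) ⟩
      (K + L) * n ^ t                                   ∎
      where
      open ≤-Reasoning
      shift : ∀ x y z → ∣ x + z - y + z ∣ ≡ ∣ x - y ∣
      shift x y z = trans (cong₂ ∣_-_∣ (+-comm x z) (+-comm y z)) (∣m+n-m+o∣≡∣n-o∣ z x y)

    close-*ˡ : ∀ c {a b} → Close t a b → Close t (λ n → c * a n) (λ n → c * b n)
    close-*ˡ c {a} {b} (close K ab) = close (c * K) λ n n≥1 → begin
      ∣ c * a n - c * b n ∣ ≡⟨ sym (*-distribˡ-∣-∣ c (a n) (b n)) ⟩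
      c * ∣ a n - b n ∣     ≤⟨ *-monoʳ-≤ c (ab n n≥1) ⟩
      c * (K * n ^ t)       ≡⟨ sym (*-assoc c K (n ^ t)) ⟩
      c * K * n ^ t         ∎
      where open ≤-Reasoning

    close-≤ : ∀ {a b} K → (∀ n → 1 ≤ n → a n ≤ b n) → (∀ n → 1 ≤ n → b n ≤ a n + K * n ^ t) → Close t a b
    close-≤ {a} {b} K a≤b b≤a+ = close K λ n n≥1 →
      subst (_≤ K * n ^ t) (sym (m≤n⇒∣m-n∣≡n∸m (a≤b n n≥1))) (m≤n+o⇒m∸n≤o (b n) (a n) (b≤a+ n n≥1))

    close-const : ∀ c → Close t (λ _ → c) (λ _ → 0)
    close-const c = close c λ n n≥1 → ≤-trans (≤-reflexive (∣-∣-identityʳ c)) (m≤m*n c (n ^ t) {{>-nonZero (1≤^ n≥1)}})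

    -- Closeness survives halving the argument (the value at 0 only costs a constant).
    close-half : ∀ {a b} → Close t a b → Close t (λ n → a ⌊ n /2⌋) (λ n → b ⌊ n /2⌋)
    close-half {a} {b} (close K ab) = close (K + ∣ a 0 - b 0 ∣) bound
      where
      bound : ∀ n → 1 ≤ n → ∣ a ⌊ n /2⌋ - b ⌊ n /2⌋ ∣ ≤ (K + ∣ a 0 - b 0 ∣) * n ^ t
      bound n n≥1 with ⌊ n /2⌋ | ⌊n/2⌋≤n n
      ... | zero  | _ = ≤-trans (m≤m*n _ (n ^ t) {{>-nonZero (1≤^ n≥1)}}) (*-monoˡ-≤ (n ^ t) (m≤n+m _ K))
      ... | suc h | h<n = begin
        ∣ a (suc h) - b (suc h) ∣   ≤⟨ ab (suc h) (s≤s z≤n) ⟩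
        K * suc h ^ t               ≤⟨ *-monoʳ-≤ K (^-monoˡ-≤ t h<n) ⟩
        K * n ^ t                   ≤⟨ *-monoˡ-≤ (n ^ t) (m≤m+n K _) ⟩
        (K + ∣ a 0 - b 0 ∣) * n ^ t ∎
        where open ≤-Reasoning

module Powers where

  open import Data.Nat
  open import Data.Nat.Properties
  open import Relation.Binary.PropositionalEquality
  open import Algebra.Properties.CommutativeSemigroup *-commutativeSemigroup using (interchange; x∙yz≈y∙xz)

  *-^ : ∀ a b k → (a * b) ^ k ≡ a ^ k * b ^ k
  *-^ a b zero    = refl
  *-^ a b (suc k) = trans (cong (a * b *_) (*-^ a b k)) (interchange a b (a ^ k) (b ^ k))

  suc-^ : ∀ x k → suc x ^ suc k ≤ x ^ suc k + suc k * suc x ^ k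
  suc-^ x zero    = ≤-reflexive (+-comm 1 (x * 1))
  suc-^ x (suc k) = begin
    suc x * suc x ^ suc k                                 ≤⟨ *-monoʳ-≤ (suc x) (suc-^ x k) ⟩
    suc x * (A + suc k * suc x ^ k)                       ≡⟨ *-distribˡ-+ (suc x) A _ ⟩
    (A + x * A) + suc x * (suc k * suc x ^ k)             ≡⟨ cong ((A + x * A) +_) (x∙yz≈y∙xz (suc x) (suc k) (suc x ^ k)) ⟩
    (A + x * A) + suc k * suc x ^ suc k                   ≡⟨ cong (_+ suc k * suc x ^ suc k) (+-comm A (x * A)) ⟩
    (x * A + A) + suc k * suc x ^ suc k                   ≡⟨ +-assoc (x * A) A _ ⟩
    x * A + (A + suc k * suc x ^ suc k)                   ≤⟨ +-monoʳ-≤ (x * A) (+-monoˡ-≤ _ (^-monoˡ-≤ (suc k) (n≤1+n x))) ⟩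
    x ^ suc (suc k) + suc (suc k) * suc x ^ suc k         ∎
    where
    open ≤-Reasoning
    A = x ^ suc k

module Growth (t : ℕ) where

  open import Data.Nat
  open import Data.Nat.Properties
  open import Data.Nat.Combinatorics using (_C_; nCn≡1)
  open import Data.Nat.Combinatorics.Base using (_P′_)
  open import Data.Product using (_,_)
  open import Data.Sum using (inj₁; inj₂)
  open import Data.Nat.Solver using (module +-*-Solver)
  open +-*-Solver using (solve; _:+_; _:*_; _:=_; con)
  open import Relation.Binary.PropositionalEquality
  open FiniteSums using (Σ; Σ-bound; halves)
  open FallingFactorial
  open Closeness
  open Powers

  s : ℕ
  s = suc t

  open CombinatorialIdentity s using (weight; S′)

  -- 2 s! S(n,s) + s!, an integer; G n ≈ 2^s n^s is the content of the asymptotics.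
  G : ℕ → ℕ
  G n = 2 * s ! * S′ n

  -- All but the top term q = s of S′ are O(n^t).
  lower : ℕ → ℕ
  lower n = Σ t (λ j → weight j * (n C suc j))

  S′-split : ∀ n → S′ n ≡ lower n + 2 ^ t * (n C s)
  S′-split n = cong (λ c → lower n + c * (n C s)) (trans (cong (_* 2 ^ t) (nCn≡1 s)) (*-identityˡ (2 ^ t)))

  G-split : ∀ n → G n ≡ 2 * s ! * lower n + 2 ^ s * (n P′ s)
  G-split n = begin
    2 * s ! * S′ n                                   ≡⟨ cong (2 * s ! *_) (S′-split n) ⟩
    2 * s ! * (lower n + 2 ^ t * (n C s))            ≡⟨ solve 4 (λ f l p c → con 2 :* f :* (l :+ p :* c) := con 2 :* f :* l :+ (con 2 :* p) :* (f :* c)) refl (s !) (lower n) (2 ^ t) (n C s) ⟩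
    2 * s ! * lower n + 2 ^ s * (s ! * (n C s))      ≡⟨ cong (λ x → 2 * s ! * lower n + 2 ^ s * x) (k!C≡P′ n s) ⟩
    2 * s ! * lower n + 2 ^ s * (n P′ s)               ∎
    where open ≡-Reasoning

  -- (n choose j+1) ≤ n^(j+1) ≤ n^t for j < t and n ≥ 1.
  lower-bound : ∀ n → 1 ≤ n → lower n ≤ Σ t weight * n ^ t
  lower-bound n@(suc _) _ = Σ-bound t _ weight (n ^ t) λ j j<t →
    *-monoʳ-≤ (weight j) (≤-trans (C≤^ n (suc j)) (^-monoʳ-≤ n j<t))

  lower-close : Close t (λ _ → 0) (λ n → 2 * s ! * lower n)
  lower-close = close-≤ (2 * s ! * Σ t weight) (λ _ _ → z≤n) λ n n≥1 →
    ≤-trans (*-monoʳ-≤ (2 * s !) (lower-bound n n≥1)) (≤-reflexive (sym (*-assoc (2 * s !) _ (n ^ t))))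

  P′-close : Close t (λ n → n P′ s) (λ n → n ^ s)
  P′-close with ^≤P′ t
  ... | c , bound = close-≤ c (λ n _ → P′≤^ n s) (λ n _ → bound n)

  G-close : Close t G (λ n → 2 ^ s * n ^ s)
  G-close = close-trans (close-≡ G-split) (close-+ (close-sym lower-close) (close-*ˡ (2 ^ s) P′-close))

  -- 2^s ⌊n/2⌋^s = (2⌊n/2⌋)^s is n^s up to O(n^t): equal for even n, and (m+1)^s − m^s ≤ s (m+1)^t.
  half-close : Close t (λ n → 2 ^ s * ⌊ n /2⌋ ^ s) (λ n → n ^ s)
  half-close = close-≤ s below above
    where
    double : ∀ n → 2 ^ s * ⌊ n /2⌋ ^ s ≡ (⌊ n /2⌋ + ⌊ n /2⌋) ^ s
    double n = trans (sym (*-^ 2 ⌊ n /2⌋ s)) (cong (λ h → (⌊ n /2⌋ + h) ^ s) (+-identityʳ ⌊ n /2⌋))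

    below : ∀ n → 1 ≤ n → 2 ^ s * ⌊ n /2⌋ ^ s ≤ n ^ s
    below n _ with halves n
    ... | inj₁ e = ≤-reflexive (trans (double n) (cong (_^ s) (sym e)))
    ... | inj₂ e = ≤-trans (≤-reflexive (double n)) (^-monoˡ-≤ s (≤-trans (n≤1+n _) (≤-reflexive (sym e))))

    above : ∀ n → 1 ≤ n → n ^ s ≤ 2 ^ s * ⌊ n /2⌋ ^ s + s * n ^ t
    above n _ with halves n
    ... | inj₁ e = ≤-trans (≤-reflexive (trans (cong (_^ s) e) (sym (double n)))) (m≤m+n _ _)
    ... | inj₂ e = begin
      n ^ s                                      ≡⟨ cong (_^ s) e ⟩
      suc m ^ s                                  ≤⟨ suc-^ m t ⟩
      m ^ s + s * suc m ^ t                      ≡⟨ cong₂ (λ x y → x + s * y ^ t) (sym (double n)) (sym e) ⟩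
      2 ^ s * ⌊ n /2⌋ ^ s + s * n ^ t            ∎
      where
      open ≤-Reasoning
      m = ⌊ n /2⌋ + ⌊ n /2⌋

  -- The integer forms of the data: G n = 2 s! S(n,s) + s!, and GN n = 2 s! N(n,s) + 2 s! by the
  -- identity; YS and YN are the corresponding forms of the claimed asymptotes.
  GN YS YN : ℕ → ℕ
  GN n = G n + G ⌊ n /2⌋
  YS n = 2 ^ s * n ^ s
  YN n = 2 ^ s * n ^ s + n ^ s

  YS-large : ∀ n → n ^ s ≤ YS n
  YS-large n = m≤n*m (n ^ s) (2 ^ s) {{m^n≢0 2 s}}

  YN-large : ∀ n → n ^ s ≤ YN n
  YN-large n = m≤n+m (n ^ s) (YS n)

  S-close : Close t (λ n → G n + s !) YS
  S-close = close-trans (close-+ G-close (close-const (s !))) (close-≡ (λ n → +-identityʳ (YS n)))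

  N-close : Close t (λ n → GN n + 2 * s !) YN
  N-close = close-trans
    (close-+ (close-+ G-close (close-trans (close-half G-close) half-close)) (close-const (2 * s !)))
    (close-≡ (λ n → +-identityʳ (YN n)))

module Dominance where

  open import Data.Nat
  open import Data.Nat.Properties
  open import Data.Nat.Solver using (module +-*-Solver)
  open +-*-Solver using (solve; _:*_; _:=_; con)
  open import Relation.Binary.PropositionalEquality

  -- Once n ≥ 1 + 2B + 2Kk, a discrepancy D ≤ K n^t is negligible against Y ≥ n^(t+1):
  -- even k D together with B fits below Y.
  dominated : ∀ t {n} k K B D Y → suc (2 * B + 2 * (K * k)) ≤ n → n ^ suc t ≤ Y → D ≤ K * n ^ t → k * D + B ≤ Y
  dominated t {n@(suc _)} k K B D Y n-large Y-large D-small = *-cancelˡ-≤ 2 (begin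
    2 * (k * D + B)             ≡⟨ *-distribˡ-+ 2 (k * D) B ⟩
    2 * (k * D) + 2 * B         ≤⟨ +-mono-≤ kD-small B-small ⟩
    n * n ^ t + n * n ^ t       ≡⟨ cong (n * n ^ t +_) (sym (+-identityʳ (n * n ^ t))) ⟩
    2 * n ^ suc t               ≤⟨ *-monoʳ-≤ 2 Y-large ⟩
    2 * Y                       ∎)
    where
    open ≤-Reasoning
    2B≤n : 2 * B ≤ n
    2B≤n = ≤-trans (m≤m+n (2 * B) _) (≤-trans (n≤1+n _) n-large)
    2Kk≤n : 2 * (K * k) ≤ n
    2Kk≤n = ≤-trans (m≤n+m (2 * (K * k)) (2 * B)) (≤-trans (n≤1+n _) n-large)
    n≤n*n^t : n ≤ n * n ^ t
    n≤n*n^t = m≤m*n n (n ^ t) {{>-nonZero (m^n>0 n t)}}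
    kD-small : 2 * (k * D) ≤ n * n ^ t
    kD-small = begin
      2 * (k * D)           ≤⟨ *-monoʳ-≤ 2 (*-monoʳ-≤ k D-small) ⟩
      2 * (k * (K * n ^ t)) ≡⟨ solve 3 (λ k K x → con 2 :* (k :* (K :* x)) := con 2 :* (K :* k) :* x) refl k K (n ^ t) ⟩
      2 * (K * k) * n ^ t   ≤⟨ *-monoˡ-≤ (n ^ t) 2Kk≤n ⟩
      n * n ^ t             ∎
    B-small : 2 * B ≤ n * n ^ t
    B-small = ≤-trans 2B≤n n≤n*n^t

module Asymptotics where

  open import Defs using (_∼_)
  open import Data.Nat as ℕ using (ℕ; zero; suc; z≤n; s≤s)
  import Data.Nat.Properties as ℕ
  open import Data.Integer as ℤ using (+_; +[1+_]; -[1+_])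
  open import Data.Rational
  open import Data.Rational.Properties
  open import Data.Product using (∃-syntax; _,_)
  open import Relation.Binary.PropositionalEquality
  open Embedding
  open Closeness using (Close)
  open Dominance
  open import Data.Rational.Solver using (module +-*-Solver)
  open +-*-Solver using (solve; _:+_; _:-_; _:*_; _:=_)
  open import Algebra.Bundles using (CommutativeMonoid)
  open import Algebra.Properties.CommutativeSemigroup (CommutativeMonoid.commutativeSemigroup *-1-commutativeMonoid) using (x∙yz≈y∙xz)

  archimedean : ∀ ε → 0ℚ < ε → ∃[ k ] 1ℚ ≤ ε * ⟦ k ⟧
  archimedean ε@(mkℚ +[1+ a ] d _) _ = suc d , (begin
    1ℚ                                ≤⟨ ⟦≤⟧ (s≤s (z≤n {a})) ⟩
    ⟦ suc a ⟧                          ≡⟨ sym (/-*-cancel (suc a) (suc d)) ⟩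
    (+[1+ a ] / suc d) * ⟦ suc d ⟧    ≡⟨ cong (_* ⟦ suc d ⟧) (↥p/↧p≡p ε) ⟩
    ε * ⟦ suc d ⟧                     ∎)
    where open ≤-Reasoning
  archimedean (mkℚ (+ zero) d _) (*<* (ℤ.+<+ ()))
  archimedean (mkℚ -[1+ a ] d _) (*<* ())

  ⟦⟧*∣∣ : ∀ c x → ⟦ c ⟧ * ∣ x ∣ ≡ ∣ ⟦ c ⟧ * x ∣
  ⟦⟧*∣∣ c x = trans (cong (_* ∣ x ∣) (sym (∣⟦⟧∣ c))) (sym (∣p*q∣≡∣p∣*∣q∣ ⟦ c ⟧ x))

  -- Setting: after scaling by a positive integer c, f is an integer sequence F and g is Y − B,
  -- where Y ≥ n^(t+1) and F + B is within O(n^t) of Y.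
  module _ t (f g : ℕ → ℚ) c .{{_ : ℕ.NonZero c}} (F Y : ℕ → ℕ) B
           (f≡ : ∀ n → ⟦ c ⟧ * f n ≡ ⟦ F n ⟧) (g≡ : ∀ n → ⟦ c ⟧ * g n ≡ ⟦ Y n ⟧ - ⟦ B ⟧)
           (Y-large : ∀ n → n ℕ.^ suc t ℕ.≤ Y n) (near : Close t (λ n → F n ℕ.+ B) Y) where

    open Close near using (K; bound)

    D : ℕ → ℕ
    D n = ℕ.∣ F n ℕ.+ B - Y n ∣

    scaled-difference : ∀ n → ⟦ c ⟧ * ∣ f n - g n ∣ ≡ ⟦ D n ⟧
    scaled-difference n = begin-equality
      ⟦ c ⟧ * ∣ f n - g n ∣                ≡⟨ ⟦⟧*∣∣ c (f n - g n) ⟩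
      ∣ ⟦ c ⟧ * (f n - g n) ∣              ≡⟨ cong ∣_∣ (solve 3 (λ c x y → c :* (x :- y) := c :* x :- c :* y) refl ⟦ c ⟧ (f n) (g n)) ⟩
      ∣ ⟦ c ⟧ * f n - ⟦ c ⟧ * g n ∣        ≡⟨ cong₂ (λ x y → ∣ x - y ∣) (f≡ n) (g≡ n) ⟩
      ∣ ⟦ F n ⟧ - (⟦ Y n ⟧ - ⟦ B ⟧) ∣      ≡⟨ cong ∣_∣ (solve 3 (λ x y b → x :- (y :- b) := x :+ b :- y) refl ⟦ F n ⟧ ⟦ Y n ⟧ ⟦ B ⟧) ⟩
      ∣ ⟦ F n ⟧ + ⟦ B ⟧ - ⟦ Y n ⟧ ∣        ≡⟨ cong (λ x → ∣ x - ⟦ Y n ⟧ ∣) (sym (⟦+⟧ (F n) B)) ⟩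
      ∣ ⟦ F n ℕ.+ B ⟧ - ⟦ Y n ⟧ ∣          ≡⟨ ⟦∣-∣⟧ (F n ℕ.+ B) (Y n) ⟩
      ⟦ D n ⟧                              ∎
      where open ≤-Reasoning

    scaled-g : ∀ n → ⟦ c ⟧ * ∣ g n ∣ ≡ ⟦ ℕ.∣ Y n - B ∣ ⟧
    scaled-g n = trans (⟦⟧*∣∣ c (g n)) (trans (cong ∣_∣ (g≡ n)) (⟦∣-∣⟧ (Y n) B))

    negligible : ∀ k n → suc (2 ℕ.* B ℕ.+ 2 ℕ.* (K ℕ.* k)) ℕ.≤ n → k ℕ.* D n ℕ.≤ ℕ.∣ Y n - B ∣
    negligible k n n-large =
      subst (k ℕ.* D n ℕ.≤_) (sym (ℕ.m≤n⇒∣n-m∣≡n∸m (ℕ.≤-trans (ℕ.m≤n+m B _) kD+B≤Y))) (ℕ.m+n≤o⇒m≤o∸n (k ℕ.* D n) kD+B≤Y)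
      where
      kD+B≤Y : k ℕ.* D n ℕ.+ B ℕ.≤ Y n
      kD+B≤Y = dominated t k K B (D n) (Y n) n-large (Y-large n) (bound n (ℕ.≤-trans (s≤s z≤n) n-large))

    -- Then f ∼ g: for ε ≥ 1/k, beyond n = 1 + 2B + 2Kk we get c ∣f − g∣ ≤ ε c ∣g∣.
    ∼-from-close : f ∼ g
    ∼-from-close ε ε>0 with archimedean ε ε>0
    ... | k , 1≤εk = suc (2 ℕ.* B ℕ.+ 2 ℕ.* (K ℕ.* k)) , λ n n-large → *-cancelˡ-≤-pos ⟦ c ⟧ {{normalize-pos c 1}} (begin
      ⟦ c ⟧ * ∣ f n - g n ∣       ≡⟨ scaled-difference n ⟩
      ⟦ D n ⟧                     ≡⟨ sym (*-identityˡ ⟦ D n ⟧) ⟩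
      1ℚ * ⟦ D n ⟧                ≤⟨ *-monoʳ-≤-nonNeg ⟦ D n ⟧ {{nonNegative (⟦≤⟧ {0} {D n} z≤n)}} 1≤εk ⟩
      ε * ⟦ k ⟧ * ⟦ D n ⟧         ≡⟨ trans (*-assoc ε ⟦ k ⟧ ⟦ D n ⟧) (cong (ε *_) (sym (⟦*⟧ k (D n)))) ⟩
      ε * ⟦ k ℕ.* D n ⟧           ≤⟨ *-monoˡ-≤-nonNeg ε {{pos⇒nonNeg ε {{positive ε>0}}}} (⟦≤⟧ (negligible k n n-large)) ⟩
      ε * ⟦ ℕ.∣ Y n - B ∣ ⟧       ≡⟨ cong (ε *_) (sym (scaled-g n)) ⟩
      ε * (⟦ c ⟧ * ∣ g n ∣)       ≡⟨ x∙yz≈y∙xz ε ⟦ c ⟧ ∣ g n ∣ ⟩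
      ⟦ c ⟧ * (ε * ∣ g n ∣)       ∎)
      where open ≤-Reasoning

module Scaling (t : ℕ) where

  open import Defs
  open import Data.Nat as ℕ using (ℕ; zero; suc; z≤n; s≤s; _^_; _!; _∸_; ⌊_/2⌋)
  open import Data.Nat.DivMod using (m/n≡1+[m∸n]/n)
  open import Data.Nat.Properties using (_!≢0; m*n≢0)
  open import Data.Rational using (1ℚ; ½; _+_; _*_; _-_; -_)
  open import Data.Rational.Properties using (*-distribˡ-+)
  open import Data.Rational.Solver using (module +-*-Solver)
  open import Relation.Binary.PropositionalEquality
  open +-*-Solver using (solve; _:+_; _:-_; _:*_; _:=_; con)
  open Embedding
  open Growth t using (s; G; GN; YS; YN)
  open CombinatorialIdentity s using (S′; N′; N′-identity)
  open Bridge s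

  -- The statement halves with division; our lemmas use ⌊_/2⌋.
  n/2≡⌊n/2⌋ : ∀ n → n ℕ./ 2 ≡ ⌊ n /2⌋
  n/2≡⌊n/2⌋ zero          = refl
  n/2≡⌊n/2⌋ (suc zero)    = refl
  n/2≡⌊n/2⌋ (suc (suc n)) = trans (m/n≡1+[m∸n]/n {suc (suc n)} {2} (s≤s (s≤s z≤n))) (cong suc (n/2≡⌊n/2⌋ n))

  identity : ∀ n → Nfun n s ≡ Sfun n s + Sfun (n ℕ./ 2) s
  identity n = begin
    Nfun n s                      ≡⟨ Nfun≡N′ n ⟩
    ⟦ N′ n ⟧                      ≡⟨ cong ⟦_⟧ (N′-identity n) ⟩
    ⟦ S′ n ℕ.+ S′ ⌊ n /2⌋ ⟧       ≡⟨ ⟦+⟧ (S′ n) (S′ ⌊ n /2⌋) ⟩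
    ⟦ S′ n ⟧ + ⟦ S′ ⌊ n /2⌋ ⟧     ≡⟨ sym (cong₂ _+_ (Sfun≡S′ n) (trans (cong (λ m → Sfun m s) (n/2≡⌊n/2⌋ n)) (Sfun≡S′ ⌊ n /2⌋))) ⟩
    Sfun n s + Sfun (n ℕ./ 2) s   ∎
    where open ≡-Reasoning

  -- The positive integer c = 2 s! by which everything is scaled to land in the integers.
  c : ℕ
  c = 2 ℕ.* s !

  instance
    c≢0 : ℕ.NonZero c
    c≢0 = m*n≢0 2 (s !) {{_}} {{s !≢0}}

  scaled-S : ∀ n → ⟦ c ⟧ * Sfun n s ≡ ⟦ G n ⟧
  scaled-S n = trans (cong (⟦ c ⟧ *_) (Sfun≡S′ n)) (sym (⟦*⟧ c (S′ n)))

  scaled-N : ∀ n → ⟦ c ⟧ * Nfun n s ≡ ⟦ GN n ⟧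
  scaled-N n = begin
    ⟦ c ⟧ * Nfun n s                                  ≡⟨ cong (⟦ c ⟧ *_) (identity n) ⟩
    ⟦ c ⟧ * (Sfun n s + Sfun (n ℕ./ 2) s)             ≡⟨ *-distribˡ-+ ⟦ c ⟧ (Sfun n s) _ ⟩
    ⟦ c ⟧ * Sfun n s + ⟦ c ⟧ * Sfun (n ℕ./ 2) s       ≡⟨ cong₂ _+_ (scaled-S n) (trans (cong (λ m → ⟦ c ⟧ * Sfun m s) (n/2≡⌊n/2⌋ n)) (scaled-S ⌊ n /2⌋)) ⟩
    ⟦ G n ⟧ + ⟦ G ⌊ n /2⌋ ⟧                           ≡⟨ sym (⟦+⟧ (G n) (G ⌊ n /2⌋)) ⟩
    ⟦ G n ℕ.+ G ⌊ n /2⌋ ⟧                             ∎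
    where open ≡-Reasoning

  powOverFact-cancel : ∀ n → powOverFact n s * ⟦ s ! ⟧ ≡ ⟦ n ^ s ⟧
  powOverFact-cancel n = /-*-cancel (n ^ s) (s !) {{s !≢0}}

  scaled-S-asymptote : ∀ n → ⟦ c ⟧ * (- ½ + ℕ→ℚ (2 ^ (s ∸ 1)) * powOverFact n s) ≡ ⟦ YS n ⟧ - ⟦ s ! ⟧
  scaled-S-asymptote n = begin
    ⟦ 2 ℕ.* s ! ⟧ * (- ½ + ⟦ 2 ^ t ⟧ * x)              ≡⟨ cong (_* (- ½ + ⟦ 2 ^ t ⟧ * x)) (⟦*⟧ 2 (s !)) ⟩
    ⟦ 2 ⟧ * f * (- ½ + ⟦ 2 ^ t ⟧ * x)                  ≡⟨ solve 3 (λ f p x → con ⟦ 2 ⟧ :* f :* (con (- ½) :+ p :* x) := con ⟦ 2 ⟧ :* p :* (x :* f) :- f) refl f ⟦ 2 ^ t ⟧ x ⟩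
    ⟦ 2 ⟧ * ⟦ 2 ^ t ⟧ * (x * f) - f                    ≡⟨ cong₂ (λ y z → y * z - f) (sym (⟦*⟧ 2 (2 ^ t))) (powOverFact-cancel n) ⟩
    ⟦ 2 ^ s ⟧ * ⟦ n ^ s ⟧ - f                          ≡⟨ cong (_- f) (sym (⟦*⟧ (2 ^ s) (n ^ s))) ⟩
    ⟦ 2 ^ s ℕ.* n ^ s ⟧ - ⟦ s ! ⟧                      ∎
    where
    open ≡-Reasoning
    f = ⟦ s ! ⟧
    x = powOverFact n s

  scaled-N-asymptote : ∀ n → ⟦ c ⟧ * (- 1ℚ + ½ * (ℕ→ℚ (2 ^ s) + 1ℚ) * powOverFact n s)
                             ≡ ⟦ YN n ⟧ - ⟦ c ⟧
  scaled-N-asymptote n = begin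
    ⟦ 2 ℕ.* s ! ⟧ * (- 1ℚ + ½ * (p + 1ℚ) * x)            ≡⟨ cong (_* (- 1ℚ + ½ * (p + 1ℚ) * x)) (⟦*⟧ 2 (s !)) ⟩
    ⟦ 2 ⟧ * f * (- 1ℚ + ½ * (p + 1ℚ) * x)                ≡⟨ solve 3 (λ f p x → con ⟦ 2 ⟧ :* f :* (con (- 1ℚ) :+ con ½ :* (p :+ con 1ℚ) :* x) := p :* (x :* f) :+ x :* f :- con ⟦ 2 ⟧ :* f) refl f p x ⟩
    p * (x * f) + x * f - ⟦ 2 ⟧ * f                      ≡⟨ cong₂ (λ y z → p * y + y - z) (powOverFact-cancel n) (sym (⟦*⟧ 2 (s !))) ⟩
    p * ⟦ n ^ s ⟧ + ⟦ n ^ s ⟧ - ⟦ 2 ℕ.* s ! ⟧            ≡⟨ cong (_- ⟦ 2 ℕ.* s ! ⟧) (sym (trans (⟦+⟧ (2 ^ s ℕ.* n ^ s) (n ^ s)) (cong (_+ ⟦ n ^ s ⟧) (⟦*⟧ (2 ^ s) (n ^ s))))) ⟩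
    ⟦ 2 ^ s ℕ.* n ^ s ℕ.+ n ^ s ⟧ - ⟦ 2 ℕ.* s ! ⟧        ∎
    where
    open ≡-Reasoning
    f = ⟦ s ! ⟧
    p = ⟦ 2 ^ s ⟧
    x = powOverFact n s

open import Defs
open import Data.Nat using (ℕ; _≤_; _/_; _^_; _∸_)
open import Data.Product using (_×_)
open import Data.Rational using (ℚ; 1ℚ; ½; _+_; _*_; -_)
open import Relation.Binary.PropositionalEquality using (_≡_)
open import Data.Nat using (suc)
open import Data.Product using (_,_)

-- The identity holds for every n; each asymptotic statement is a closeness estimate of
-- order s − 1 in the integers, transported along the scaling by c = 2 s!.
theorem2 : (s : ℕ) → 1 ≤ s →
    (∀ (n : ℕ) → 1 ≤ n → Nfun n s ≡ Sfun n s + Sfun (n / 2) s)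
    × ((λ n → Sfun n s) ∼ (λ n → - ½ + ℕ→ℚ (2 ^ (s ∸ 1)) * powOverFact n s))
    × ((λ n → Nfun n s) ∼ (λ n → - 1ℚ + ½ * (ℕ→ℚ (2 ^ s) + 1ℚ) * powOverFact n s))
theorem2 (suc t) _ =
    (λ n _ → identity n)
  , ∼-from-close t _ _ c G  YS (s !) scaled-S scaled-S-asymptote YS-large S-close
  , ∼-from-close t _ _ c GN YN c      scaled-N scaled-N-asymptote YN-large N-close
  where
  open Scaling t
  open Growth t using (s; G; GN; YS; YN; YS-large; YN-large; S-close; N-close)
  open Asymptotics using (∼-from-close)
  open Data.Nat using (_!)
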